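{- Let $\mathcal{C}$ be a complete code on $n$ neurons with $|\mathcal{C}|=m$. Then $\mathcal{C}$ is isomorphic to the code $\mathscr{C}_m=\{\emptyset,\{1\},\{1,2\},\dots,\{1,2,\dots,m-1\}\}$ (a code on $m-1$ neurons).
   Context: A neural code on $n$ neurons is a collection of subsets of $[n]$. The codeword containment graph $G_\mathcal{C}$ has vertex set $\mathcal{C}$, with $\sigma,\tau$ adjacent iff $\sigma\subsetneq\tau$ or $\tau\subsetneq\sigma$; $\mathcal{C}$ is a complete code if $G_\mathcal{C}$ is a complete graph. For $\sigma\subseteq[n]$, the trunk $\mathrm{Tk}_\mathcal{C}(\sigma)=\{c\in\mathcal{C}\mid\sigma\subseteq c\}$; a subset of $\mathcal{C}$ is a trunk if it is empty or equals some $\mathrm{Tk}_\mathcal{C}(\sigma)$. A function $f:\mathcal{C}\to\mathcal{D}$ between codes is a morphism if the preimage of every trunk in $\mathcal{D}$ is a trunk in $\mathcal{C}$; it is an isomorphism if it has an inverse function that is also a morphism; two codes are isomorphic if there is an isomorphism between them. -}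

module Defs where

open import Data.Nat using (ℕ; _∸_; _<ᵇ_)
open import Data.Fin using (Fin; toℕ)
open import Data.Fin.Subset using (Subset; _⊆_; _⊂_)
open import Data.Vec using (tabulate)
open import Data.List using (List; map; upTo)
import Data.List.Membership.Propositional as LM
open import Data.List.Relation.Unary.Unique.Propositional using (Unique)
open import Data.Product using (Σ; ∃; _×_; proj₁)
open import Data.Sum using (_⊎_)
open import Relation.Nullary using (¬_)
open import Relation.Binary.PropositionalEquality using (_≡_; _≢_)
open import Level using (suc; zero)

-- A neural code on n neurons: a finite collection of subsets of [n] = Fin n,
-- represented as a list of subsets
-- (duplicate-freeness is imposed as a separate hypothesis `IsSetCode`).
Code : ℕ → Set
Code n = List (Subset n)

words : ∀ {n} → Code n → List (Subset n)
words C = C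

IsSetCode : ∀ {n} → Code n → Set
IsSetCode C = Unique C

Codeword : ∀ {n} → Code n → Set
Codeword {n} C = Σ (Subset n) (λ c → c LM.∈ words C)


size : ∀ {n} → Code n → ℕ
size C = Data.List.length (words C)

IsComplete : ∀ {n} → Code n → Set
IsComplete C = ∀ (a b : Codeword C) → proj₁ a ≢ proj₁ b →
  (proj₁ a ⊂ proj₁ b) ⊎ (proj₁ b ⊂ proj₁ a)

-- Subsets of C are predicates on codewords.
-- T is a trunk iff it is empty or equals Tk_C(σ) = {c ∈ C | σ ⊆ c} for some σ ⊆ [n].
IsTrunk : ∀ {n} (C : Code n) → (Codeword C → Set) → Set
IsTrunk {n} C T =
  (∀ c → ¬ T c) ⊎
  ∃ λ (σ : Subset n) → ∀ c → (T c → σ ⊆ proj₁ c) × (σ ⊆ proj₁ c → T c)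

IsMorphism : ∀ {n n'} (C : Code n) (D : Code n') → (Codeword C → Codeword D) → Set₁
IsMorphism C D f = ∀ (T : Codeword D → Set) → IsTrunk D T → IsTrunk C (λ c → T (f c))

Isomorphic : ∀ {n n'} → Code n → Code n' → Set₁
Isomorphic C D =
  Σ (Codeword C → Codeword D) λ f →
  Σ (Codeword D → Codeword C) λ g →
    IsMorphism C D f × IsMorphism D C g ×
    (∀ c → proj₁ (g (f c)) ≡ proj₁ c) × (∀ d → proj₁ (f (g d)) ≡ proj₁ d)

-- The subset {1,...,k} of [N] (i.e. the first k neurons).
initialSeg : (N k : ℕ) → Subset N
initialSeg N k = tabulate (λ (i : Fin N) → toℕ i <ᵇ k)

stairCode : (m : ℕ) → Code (m ∸ 1)
stairCode m = map (initialSeg (m ∸ 1)) (upTo m)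

-- A complete code is a chain under inclusion, so ranking each codeword by the
-- number of codewords strictly below it is an order isomorphism of C onto
-- {0, …, m−1}; the stair code is ordered the same way by its number of neurons.
-- An order isomorphism between two codes is an isomorphism of codes: the
-- preimage of the trunk Tk(σ) is the trunk of the first codeword whose image
-- contains σ.
module Submission where

open import Defs
open import Data.Nat as ℕ using (ℕ; zero; suc; _∸_; _<ᵇ_; z≤n; s≤s)
import Data.Nat.Properties as ℕP
open import Data.Fin using (Fin; toℕ; fromℕ<; punchOut)
import Data.Fin as F
import Data.Fin.Properties as FP
open import Data.Fin.Subset using (Subset; _⊆_; _⊂_; _∈_)
open import Data.Fin.Subset.Properties
  using (_⊆?_; _⊂?_; ⊆-reflexive; ⊆-trans; ⊆-antisym; ⊂-irref; ⊂-⊆-trans)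
import Data.Vec as Vec
import Data.Vec.Properties as VP
open import Data.Bool using (true)
import Data.Bool as B
open import Data.Bool.Properties using (T-≡)
open import Data.List using (List; _∷_; length; filter; lookup)
open import Data.List.Membership.Propositional using () renaming (_∈_ to _∈ₗ_)
open import Data.List.Membership.Propositional.Properties
  using (∈-map⁺; ∈-map⁻; ∈-upTo⁺; ∈-upTo⁻; ∈-lookup; ∈-filter⁺; ∈-filter⁻)
open import Data.List.Relation.Binary.Equality.Propositional using (≋⇒≡)
open import Data.List.Relation.Binary.Sublist.Propositional using (⊆-refl)
  renaming (_⊆_ to _⊑_)
import Data.List.Relation.Binary.Sublist.Propositional.Properties as Sublist
import Data.List.Properties as LP
import Data.List.Relation.Unary.All as All
import Data.List.Relation.Unary.Any as Any
open import Data.List.Relation.Unary.AllPairs using (_∷_)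
open import Data.List.Relation.Unary.Unique.Propositional using (Unique)
open import Data.Product using (Σ; ∃; _×_; _,_; proj₁; proj₂)
open import Data.Sum using (_⊎_; inj₁; inj₂)
open import Data.Empty using (⊥-elim)
open import Function using (_∘_; _⇔_; mk⇔; Equivalence)
open import Function.Definitions using (Injective)
open import Relation.Nullary using (¬_; yes; no)
open import Relation.Unary using (Decidable)
open import Relation.Binary.PropositionalEquality
  using (_≡_; _≢_; refl; sym; trans; cong; subst; subst₂; module ≡-Reasoning)

record ChainEnumeration {n : ℕ} (C : Code n) (m : ℕ) : Set where
  field
    index      : Codeword C → Fin m
    word       : Fin m → Codeword C
    word∘index : ∀ c → proj₁ (word (index c)) ≡ proj₁ c
    word-⊆⇒≤   : ∀ i j → proj₁ (word i) ⊆ proj₁ (word j) → i F.≤ j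
    word-≤⇒⊆   : ∀ i j → i F.≤ j → proj₁ (word i) ⊆ proj₁ (word j)

  index∘word : ∀ i → index (word i) ≡ i
  index∘word i = FP.≤-antisym
    (word-⊆⇒≤ _ _ (⊆-reflexive (word∘index (word i))))
    (word-⊆⇒≤ _ _ (⊆-reflexive (sym (word∘index (word i)))))

open ChainEnumeration

least? : ∀ {m} (P : Fin m → Set) → Decidable P →
  (∀ i → ¬ P i) ⊎ Σ (Fin m) λ k → P k × (∀ i → P i → k F.≤ i)
least? {zero} P P? = inj₁ λ ()
least? {suc m} P P? with P? F.zero | least? (P ∘ F.suc) (P? ∘ F.suc)
... | yes p₀ | _               = inj₂ (F.zero , p₀ , λ _ _ → z≤n)
... | no ¬p₀ | inj₁ none       = inj₁ λ { F.zero → ¬p₀ ; (F.suc i) → none i }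
... | no ¬p₀ | inj₂ (k , pk , min) =
  inj₂ (F.suc k , pk , λ { F.zero p₀ → ⊥-elim (¬p₀ p₀) ; (F.suc i) pi → s≤s (min i pi) })

module _ {n n′ m} {C : Code n} {D : Code n′}
         (EC : ChainEnumeration C m) (ED : ChainEnumeration D m) where

  transport : Codeword C → Codeword D
  transport c = word ED (index EC c)

  transport-isMorphism : IsMorphism C D transport
  transport-isMorphism T (inj₁ empty) = inj₁ (λ c → empty _)
  transport-isMorphism T (inj₂ (σ , trunk))
    with least? (λ i → σ ⊆ proj₁ (word ED i)) (λ i → σ ⊆? proj₁ (word ED i))
  ... | inj₁ none = inj₁ λ c t → none (index EC c) (proj₁ (trunk _) t)
  ... | inj₂ (k , σ⊆k , min) = inj₂ (proj₁ (word EC k) , λ c → to c , from c)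
    where
    k⊆c⇔k≤index : ∀ c → (proj₁ (word EC k) ⊆ proj₁ c) ⇔ (k F.≤ index EC c)
    k⊆c⇔k≤index c rewrite sym (word∘index EC c) =
      mk⇔ (word-⊆⇒≤ EC k _) (word-≤⇒⊆ EC k _)

    to : ∀ c → T (transport c) → proj₁ (word EC k) ⊆ proj₁ c
    to c t = Equivalence.from (k⊆c⇔k≤index c) (min _ (proj₁ (trunk _) t))

    from : ∀ c → proj₁ (word EC k) ⊆ proj₁ c → T (transport c)
    from c k⊆c = proj₂ (trunk _)
      (⊆-trans σ⊆k (word-≤⇒⊆ ED k _ (Equivalence.to (k⊆c⇔k≤index c) k⊆c)))

  transport-cancel : ∀ c → proj₁ (word EC (index ED (transport c))) ≡ proj₁ c
  transport-cancel c = trans (cong (proj₁ ∘ word EC) (index∘word ED _)) (word∘index EC c)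

chainEnumerations⇒isomorphic : ∀ {n n′ m} {C : Code n} {D : Code n′} →
  ChainEnumeration C m → ChainEnumeration D m → Isomorphic C D
chainEnumerations⇒isomorphic EC ED =
  transport EC ED , transport ED EC ,
  transport-isMorphism EC ED , transport-isMorphism ED EC ,
  transport-cancel EC ED , transport-cancel ED EC

∈-initialSeg⁻ : ∀ {N k} {x : Fin N} → x ∈ initialSeg N k → toℕ x ℕ.< k
∈-initialSeg⁻ {N} {k} {x} x∈ = ℕP.<ᵇ⇒< (toℕ x) k (Equivalence.from T-≡ (begin
  toℕ x <ᵇ k                    ≡⟨ VP.lookup∘tabulate _ x ⟨
  Vec.lookup (initialSeg N k) x ≡⟨ VP.[]=⇒lookup x∈ ⟩
  true                          ∎))
  where open ≡-Reasoning

∈-initialSeg⁺ : ∀ {N k} {x : Fin N} → toℕ x ℕ.< k → x ∈ initialSeg N k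
∈-initialSeg⁺ {N} {k} {x} x<k = VP.lookup⇒[]= x (initialSeg N k)
  (trans (VP.lookup∘tabulate _ x) (Equivalence.to T-≡ (ℕP.<⇒<ᵇ x<k)))

initialSeg-mono : ∀ {N a b} → a ℕ.≤ b → initialSeg N a ⊆ initialSeg N b
initialSeg-mono a≤b x∈ = ∈-initialSeg⁺ (ℕP.<-≤-trans (∈-initialSeg⁻ x∈) a≤b)

-- If b < a ≤ N, the neuron b lies in the first segment but not in the second.
initialSeg-⊆⇒≤ : ∀ {N a b} → a ℕ.≤ N → initialSeg N a ⊆ initialSeg N b → a ℕ.≤ b
initialSeg-⊆⇒≤ {N} {a} {b} a≤N a⊆b with a ℕ.≤? b
... | yes a≤b = a≤b
... | no a≰b = ⊥-elim (ℕP.<-irrefl (FP.toℕ-fromℕ< b<N) (∈-initialSeg⁻ (a⊆b (∈-initialSeg⁺ b<a′))))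
  where
  b<a : b ℕ.< a
  b<a = ℕP.≰⇒> a≰b
  b<N : b ℕ.< N
  b<N = ℕP.<-≤-trans b<a a≤N
  b<a′ : toℕ (fromℕ< b<N) ℕ.< a
  b<a′ = subst (ℕ._< a) (sym (FP.toℕ-fromℕ< b<N)) b<a

stairCode-chainEnumeration : ∀ m → ChainEnumeration (stairCode m) m
stairCode-chainEnumeration m = record
  { index      = index′
  ; word       = λ i → seg (toℕ i) , ∈-map⁺ seg (∈-upTo⁺ (FP.toℕ<n i))
  ; word∘index = word∘index′
  ; word-⊆⇒≤   = λ i j → initialSeg-⊆⇒≤ (ℕP.∸-monoˡ-≤ 1 (FP.toℕ<n i))
  ; word-≤⇒⊆   = λ i j → initialSeg-mono
  }
  where
  seg : ℕ → Subset (m ∸ 1)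
  seg = initialSeg (m ∸ 1)

  index′ : Codeword (stairCode m) → Fin m
  index′ (d , d∈) = fromℕ< (∈-upTo⁻ (proj₁ (proj₂ (∈-map⁻ seg d∈))))

  word∘index′ : ∀ c → seg (toℕ (index′ c)) ≡ proj₁ c
  word∘index′ (d , d∈) with ∈-map⁻ seg d∈
  ... | k , k∈ , refl = cong seg (FP.toℕ-fromℕ< (∈-upTo⁻ k∈))

module _ {A : Set} {P Q : A → Set} (P? : Decidable P) (Q? : Decidable Q)
         (P⇒Q : ∀ {x} → P x → Q x) where

  filter-⊑ : ∀ xs → filter P? xs ⊑ filter Q? xs
  filter-⊑ xs = Sublist.filter⁺ P? Q? (λ { refl → P⇒Q }) (⊆-refl {x = xs})

  length-filter-mono : ∀ xs → length (filter P? xs) ℕ.≤ length (filter Q? xs)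
  length-filter-mono xs = Sublist.length-mono-≤ (filter-⊑ xs)

  length-filter-strictMono : ∀ {x xs} → x ∈ₗ xs → Q x → ¬ P x →
    length (filter P? xs) ℕ.< length (filter Q? xs)
  length-filter-strictMono {x} {xs} x∈ Qx ¬Px =
    ℕP.≤∧≢⇒< (length-filter-mono xs) λ same-length →
      let filters-equal = ≋⇒≡ (Sublist.to-≋ same-length (filter-⊑ xs))
      in ¬Px (proj₂ (∈-filter⁻ P? {xs = xs} (subst (x ∈ₗ_) (sym filters-equal) (∈-filter⁺ Q? x∈ Qx))))

-- If k were missed, punching it out would inject Fin (suc m) into Fin m.
injective⇒surjective : ∀ {m} {f : Fin m → Fin m} → Injective _≡_ _≡_ f →
  ∀ k → ∃ λ i → f i ≡ k
injective⇒surjective {suc m} {f} f-injective k with FP.any? (λ i → f i FP.≟ k)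
... | yes hit = hit
... | no miss = ⊥-elim (ℕP.1+n≰n (FP.injective⇒≤ g-injective))
  where
  k≢f : ∀ i → k ≢ f i
  k≢f i k≡fi = miss (i , sym k≡fi)

  g : Fin (suc m) → Fin m
  g i = punchOut (k≢f i)

  g-injective : Injective _≡_ _≡_ g
  g-injective {i} {j} = f-injective ∘ FP.punchOut-injective (k≢f i) (k≢f j)

lookup-injective : ∀ {A : Set} {xs : List A} → Unique xs → Injective _≡_ _≡_ (lookup xs)
lookup-injective {xs = _ ∷ _} (_ ∷ _) {F.zero} {F.zero} _ = refl
lookup-injective {xs = _ ∷ _} (x∉ ∷ _) {F.zero} {F.suc j} eq = ⊥-elim (All.lookup x∉ (∈-lookup j) eq)
lookup-injective {xs = _ ∷ _} (x∉ ∷ _) {F.suc i} {F.zero} eq = ⊥-elim (All.lookup x∉ (∈-lookup i) (sym eq))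
lookup-injective {xs = _ ∷ _} (_ ∷ u) {F.suc i} {F.suc j} eq = cong F.suc (lookup-injective u eq)

module CompleteCode {n} (C : Code n) (unique : IsSetCode C) (complete : IsComplete C) where

  ⊆⊎⊃ : ∀ (a b : Codeword C) → proj₁ a ⊆ proj₁ b ⊎ proj₁ b ⊂ proj₁ a
  ⊆⊎⊃ a b with VP.≡-dec B._≟_ (proj₁ a) (proj₁ b)
  ... | yes a≡b = inj₁ (⊆-reflexive a≡b)
  ... | no a≢b with complete a b a≢b
  ...   | inj₁ a⊂b = inj₁ (proj₁ a⊂b)
  ...   | inj₂ b⊂a = inj₂ b⊂a

  rank : Subset n → ℕ
  rank s = length (filter (_⊂? s) C)

  rank-mono : ∀ {a b} → a ⊆ b → rank a ℕ.≤ rank b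
  rank-mono {a} {b} a⊆b = length-filter-mono (_⊂? a) (_⊂? b) (λ x⊂a → ⊂-⊆-trans x⊂a a⊆b) C

  rank-strictMono : ∀ {a b} → a ∈ₗ C → a ⊂ b → rank a ℕ.< rank b
  rank-strictMono {a} {b} a∈ a⊂b =
    length-filter-strictMono (_⊂? a) (_⊂? b) (λ x⊂a → ⊂-⊆-trans x⊂a (proj₁ a⊂b)) a∈ a⊂b (⊂-irref refl)

  rank<size : ∀ {a} → a ∈ₗ C → rank a ℕ.< size C
  rank<size {a} a∈ = LP.filter-notAll (_⊂? a) C (Any.map (λ { refl → ⊂-irref refl }) a∈)

  rank-injective : ∀ (a b : Codeword C) → rank (proj₁ a) ≡ rank (proj₁ b) → proj₁ a ≡ proj₁ b
  rank-injective a b same with ⊆⊎⊃ a b | ⊆⊎⊃ b a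
  ... | inj₁ a⊆b | inj₁ b⊆a = ⊆-antisym a⊆b b⊆a
  ... | _        | inj₂ a⊂b = ⊥-elim (ℕP.<-irrefl same (rank-strictMono (proj₂ a) a⊂b))
  ... | inj₂ b⊂a | _        = ⊥-elim (ℕP.<-irrefl (sym same) (rank-strictMono (proj₂ b) b⊂a))

  position : Codeword C → Fin (size C)
  position (c , c∈) = fromℕ< (rank<size c∈)

  toℕ-position : ∀ c → toℕ (position c) ≡ rank (proj₁ c)
  toℕ-position (c , c∈) = FP.toℕ-fromℕ< (rank<size c∈)

  listed : Fin (size C) → Codeword C
  listed i = lookup C i , ∈-lookup i

  position∘listed-injective : Injective _≡_ _≡_ (position ∘ listed)
  position∘listed-injective {i} {j} same = lookup-injective unique (rank-injective (listed i) (listed j) (begin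
    rank (lookup C i)          ≡⟨ toℕ-position (listed i) ⟨
    toℕ (position (listed i))  ≡⟨ cong toℕ same ⟩
    toℕ (position (listed j))  ≡⟨ toℕ-position (listed j) ⟩
    rank (lookup C j)          ∎))
    where open ≡-Reasoning

  atPosition : Fin (size C) → Codeword C
  atPosition k = listed (proj₁ (injective⇒surjective position∘listed-injective k))

  rank-atPosition : ∀ k → rank (proj₁ (atPosition k)) ≡ toℕ k
  rank-atPosition k = trans (sym (toℕ-position (atPosition k)))
    (cong toℕ (proj₂ (injective⇒surjective position∘listed-injective k)))

  atPosition∘position : ∀ c → proj₁ (atPosition (position c)) ≡ proj₁ c
  atPosition∘position c =
    rank-injective (atPosition (position c)) c (trans (rank-atPosition (position c)) (toℕ-position c))

  atPosition-⊆⇒≤ : ∀ i j → proj₁ (atPosition i) ⊆ proj₁ (atPosition j) → i F.≤ j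
  atPosition-⊆⇒≤ i j ai⊆aj = subst₂ ℕ._≤_ (rank-atPosition i) (rank-atPosition j) (rank-mono ai⊆aj)

  atPosition-≤⇒⊆ : ∀ i j → i F.≤ j → proj₁ (atPosition i) ⊆ proj₁ (atPosition j)
  atPosition-≤⇒⊆ i j i≤j with ⊆⊎⊃ (atPosition i) (atPosition j)
  ... | inj₁ ai⊆aj = ai⊆aj
  ... | inj₂ aj⊂ai = ⊥-elim (ℕP.<⇒≱ (subst₂ ℕ._<_ (rank-atPosition j) (rank-atPosition i)
                               (rank-strictMono (proj₂ (atPosition j)) aj⊂ai)) i≤j)

  chainEnumeration : ChainEnumeration C (size C)
  chainEnumeration = record
    { index      = position
    ; word       = atPosition
    ; word∘index = atPosition∘position
    ; word-⊆⇒≤   = atPosition-⊆⇒≤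
    ; word-≤⇒⊆   = atPosition-≤⇒⊆
    }

mainTheorem5 : (n m : ℕ) (C : Code n) → IsSetCode C → IsComplete C →
    size C ≡ m → Isomorphic C (stairCode m)
mainTheorem5 n .(size C) C unique complete refl =
  chainEnumerations⇒isomorphic (CompleteCode.chainEnumeration C unique complete)
                               (stairCode-chainEnumeration (size C))
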